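{- Let $\mathtt{s}$ and $\mathtt{s'}$ be closed terms of type $\mathtt{A}$. Let $\mathtt{t}$ be a closed term that is poly-typable by $\mathtt{A\to B}$ with respect to $\mathtt{s}$ and with respect to $\mathtt{s'}$, and let $\mathtt{t'}$ be a closed term that is poly-typable by $\mathtt{B\to C}$ with respect to $\mathtt{t\,s}$ and with respect to $\mathtt{t\,s'}$. Then the term $\mathtt{fn\ x=>(t'(t\ x))}$ is poly-typable by $\mathtt{A\to C}$ with respect to $\mathtt{s}$ and with respect to $\mathtt{s'}$.
   Context: Linear $\lambda$-calculus in ML-like notation. Types: $\mathtt{A} ::= \mathtt{'a} \mid \mathtt{A1 * A2} \mid \mathtt{A1 \to A2}$ ($\mathtt{'a}$ type variables, $*$ tensor, $\to$ linear implication). Terms: $\mathtt{t} ::= \mathtt{x} \mid \mathtt{t}\,\mathtt{s} \mid \mathtt{fn\ x => t} \mid \mathtt{(s,t)} \mid \mathtt{let\ val\ (x,y)=s\ in\ t\ end}$. Typing judgements $\Gamma \vdash \mathtt{t:A}$ are derived by: $\mathtt{x:A}\vdash\mathtt{x:A}$; exchange; from $\mathtt{x:A},\Gamma\vdash \mathtt{t:B}$ infer $\Gamma\vdash\mathtt{fn\ x=>t : A\to B}$; from $\Gamma\vdash\mathtt{t:A\to B}$ and $\Delta\vdash\mathtt{s:A}$ infer $\Gamma,\Delta\vdash\mathtt{t\,s:B}$; from $\Gamma\vdash\mathtt{s:A}$ and $\Delta\vdash\mathtt{t:B}$ infer $\Gamma,\Delta\vdash\mathtt{(s,t):A*B}$;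 from $\Gamma\vdash\mathtt{s:A*B}$ and $\mathtt{x:A},\mathtt{y:B},\Delta\vdash\mathtt{t:C}$ infer $\Gamma,\Delta\vdash\mathtt{let\ val\ (x,y)=s\ in\ t\ end:C}$ ($\Gamma,\Delta$ disjoint lists of distinct variables). A closed term of type $\mathtt{A}$ is a term with $\vdash\mathtt{t:A}$ derivable. Poly-typability: a type substitution maps type variables to types. The principal type $\mathrm{PT}(\mathtt{t})$ of a typable term is a type $\mathtt{A}$ with $\Gamma\vdash\mathtt{t:A}$ derivable for some $\Gamma$ such that every derivable typing of $\mathtt{t}$ is a substitution instance of it. For closed terms $\mathtt{t},\mathtt{s}$ with $\vdash\mathtt{t:A'\to B'}$ derivable for some types and $\vdash\mathtt{s:A}$, $\mathtt{t}$ is poly-typable by $\mathtt{A\to B}$ with respect to $\mathtt{s}$ if there is a type substitution $\theta$ with $\theta(\mathrm{PT}(\mathtt{t})) = \mathtt{A0\to B}$ and $\theta(\mathrm{PT}(\mathtt{s})) = \mathtt{A0}$ for some type $\mathtt{A0}$. (In that case $\mathtt{t\,s}$ is a closed term of type $\mathtt{B}$.) -}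

module Defs where

open import Data.Nat using (ℕ)
open import Data.Product using (Σ; ∃; ∃-syntax; _×_; _,_; proj₁)
open import Data.List using (List; []; _∷_; _++_; map)
open import Data.List.Relation.Unary.Unique.Propositional using (Unique)
open import Data.List.Relation.Binary.Permutation.Propositional using (_↭_)
open import Relation.Binary.PropositionalEquality using (_≡_)

data Ty : Set where
  tvar : ℕ → Ty
  _⊗_  : Ty → Ty → Ty
  _⇒_  : Ty → Ty → Ty

infixr 6 _⊗_
infixr 5 _⇒_

data Tm : Set where
  var  : ℕ → Tm
  app  : Tm → Tm → Tm
  lam  : ℕ → Tm → Tm                 -- fn x => t
  pair : Tm → Tm → Tm
  letp : ℕ → ℕ → Tm → Tm → Tm        -- let val (x,y) = s in t end

Ctx : Set
Ctx = List (ℕ × Ty)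

dom : Ctx → List ℕ
dom = map proj₁

-- Contexts in the conclusions of binary rules must be disjoint lists of
-- distinct variables (Unique (dom (Γ ++ Δ))); exchange is given by
-- permutation of the context.
infix 4 _⊢_∶_
data _⊢_∶_ : Ctx → Tm → Ty → Set where
  ax   : ∀ {x A} → ((x , A) ∷ []) ⊢ var x ∶ A
  exch : ∀ {Γ Γ' t A} → Γ ↭ Γ' → Γ ⊢ t ∶ A → Γ' ⊢ t ∶ A
  ⇒I   : ∀ {x A Γ t B} → ((x , A) ∷ Γ) ⊢ t ∶ B → Γ ⊢ lam x t ∶ (A ⇒ B)
  ⇒E   : ∀ {Γ Δ t s A B} → Unique (dom (Γ ++ Δ)) →
         Γ ⊢ t ∶ (A ⇒ B) → Δ ⊢ s ∶ A → (Γ ++ Δ) ⊢ app t s ∶ B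
  ⊗I   : ∀ {Γ Δ s t A B} → Unique (dom (Γ ++ Δ)) →
         Γ ⊢ s ∶ A → Δ ⊢ t ∶ B → (Γ ++ Δ) ⊢ pair s t ∶ (A ⊗ B)
  ⊗E   : ∀ {Γ Δ s t x y A B C} → Unique (dom (Γ ++ Δ)) →
         Γ ⊢ s ∶ (A ⊗ B) → ((x , A) ∷ (y , B) ∷ Δ) ⊢ t ∶ C →
         (Γ ++ Δ) ⊢ letp x y s t ∶ C

Closed : Tm → Ty → Set
Closed t A = [] ⊢ t ∶ A

TySubst : Set
TySubst = ℕ → Ty

sub : TySubst → Ty → Ty
sub θ (tvar a) = θ a
sub θ (A ⊗ B)  = sub θ A ⊗ sub θ B
sub θ (A ⇒ B)  = sub θ A ⇒ sub θ B

IsPT : Tm → Ty → Set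
IsPT t P = (∃[ Γ ] (Γ ⊢ t ∶ P)) ×
           (∀ Γ' A' → Γ' ⊢ t ∶ A' → ∃[ θ ] (sub θ P ≡ A'))

PolyTypable : Tm → Ty → Ty → Tm → Set
PolyTypable t A B s =
  (∃[ A' ] ∃[ B' ] Closed t (A' ⇒ B')) ×
  Closed s A ×
  (∃[ Pt ] ∃[ Ps ] (IsPT t Pt × IsPT s Ps ×
     (∃[ θ ] ∃[ A0 ] (sub θ Pt ≡ (A0 ⇒ B) × sub θ Ps ≡ A0))))

module Submission where

-- Write  compose x t t'  for  fn x => t' (t x).  The heart of the proof is
-- that this composite has a principal type whenever t and t' do and it is
-- typable: rename PT(t) and PT(t') apart, introduce fresh variables α, β, γ
-- and solve  PT(t) ≐ α ⇒ β,  PT(t') ≐ β ⇒ γ  by a most general unifier σ;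
-- then σα ⇒ σγ is principal for the composite.
-- Proposition 5 then follows separately for s and s': the typing of t s
-- supplied by the hypothesis on t' gives a typing of the composite at X ⇒ C
-- with s : X, and renaming its principal type apart from PT(s) realises both
-- instances by one substitution.

open import Defs
open import Data.Nat using (ℕ; suc; _+_; _∸_; _<_; _≤_; _⊔_; s≤s; z≤n; _<?_)
open import Data.Nat.Properties
  using (_≟_; ≤-refl; ≤-trans; <-irrefl; m≤m+n; m≤n+m; m<n+m; n≤1+n; m+n∸m≡n; m≤m⊔n; m≤n⊔m)
open import Data.Nat.Induction using (<-wellFounded)
open import Data.Nat.Tactic.RingSolver using (solve-∀)
open import Induction.WellFounded using (Acc; acc)
open import Data.Product using (Σ; ∃-syntax; _×_; _,_; proj₁; proj₂; map₂)
open import Data.Sum using (_⊎_; inj₁; inj₂; [_,_]′)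
open import Data.Empty using (⊥; ⊥-elim)
open import Function using (_∘_)
open import Data.List using (List; []; _∷_; _++_; map; length; filter)
open import Data.List.Properties using (map-++; map-∘; filter-notAll)
open import Data.List.Relation.Unary.Any as Any using (here; there)
open import Data.List.Relation.Unary.All using (All; []; _∷_) renaming (lookup to All-lookup)
open import Data.List.Relation.Unary.AllPairs using ([]; _∷_)
open import Data.List.Relation.Unary.Unique.Propositional using (Unique)
open import Data.List.Relation.Binary.Permutation.Propositional using (_↭_; ↭-sym; ↭-trans; ↭⇒↭ₛ)
open import Data.List.Relation.Binary.Permutation.Propositional.Properties using (∈-resp-↭; map⁺)
open import Data.List.Relation.Binary.Permutation.Setoid.Properties using (Unique-resp-↭)
open import Data.List.Membership.Propositional using (_∈_)
open import Data.List.Membership.Propositional.Properties using (∈-++⁺ˡ; ∈-++⁺ʳ; ∈-++⁻; ∈-filter⁺)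
open import Relation.Binary.PropositionalEquality
  using (_≡_; _≢_; refl; sym; trans; cong; cong₂; subst; setoid; ≢-sym; module ≡-Reasoning)
open import Relation.Nullary using (¬_; Dec; yes; no; ¬?)

-- 1. Type substitutions

data Occ (v : ℕ) : Ty → Set where
  occ-var : Occ v (tvar v)
  occ-⊗ˡ  : ∀ {A B} → Occ v A → Occ v (A ⊗ B)
  occ-⊗ʳ  : ∀ {A B} → Occ v B → Occ v (A ⊗ B)
  occ-⇒ˡ  : ∀ {A B} → Occ v A → Occ v (A ⇒ B)
  occ-⇒ʳ  : ∀ {A B} → Occ v B → Occ v (A ⇒ B)

occ? : ∀ v T → Dec (Occ v T)
occ? v (tvar w) with v ≟ w
... | yes refl = yes occ-var
... | no v≢w   = no λ { occ-var → v≢w refl }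
occ? v (A ⊗ B) with occ? v A | occ? v B
... | yes a | _     = yes (occ-⊗ˡ a)
... | no _  | yes b = yes (occ-⊗ʳ b)
... | no ¬a | no ¬b = no λ { (occ-⊗ˡ a) → ¬a a ; (occ-⊗ʳ b) → ¬b b }
occ? v (A ⇒ B) with occ? v A | occ? v B
... | yes a | _     = yes (occ-⇒ˡ a)
... | no _  | yes b = yes (occ-⇒ʳ b)
... | no ¬a | no ¬b = no λ { (occ-⇒ˡ a) → ¬a a ; (occ-⇒ʳ b) → ¬b b }

sub-cong : ∀ {f g : TySubst} X → (∀ w → Occ w X → f w ≡ g w) → sub f X ≡ sub g X
sub-cong (tvar v) f≗g = f≗g v occ-var
sub-cong (A ⊗ B) f≗g =
  cong₂ _⊗_ (sub-cong A (λ w → f≗g w ∘ occ-⊗ˡ)) (sub-cong B (λ w → f≗g w ∘ occ-⊗ʳ))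
sub-cong (A ⇒ B) f≗g =
  cong₂ _⇒_ (sub-cong A (λ w → f≗g w ∘ occ-⇒ˡ)) (sub-cong B (λ w → f≗g w ∘ occ-⇒ʳ))

_⊙_ : TySubst → TySubst → TySubst
(f ⊙ g) w = sub f (g w)

sub-⊙ : ∀ f g X → sub f (sub g X) ≡ sub (f ⊙ g) X
sub-⊙ f g (tvar v) = refl
sub-⊙ f g (A ⊗ B)  = cong₂ _⊗_ (sub-⊙ f g A) (sub-⊙ f g B)
sub-⊙ f g (A ⇒ B)  = cong₂ _⇒_ (sub-⊙ f g A) (sub-⊙ f g B)

sub-id : ∀ X → sub tvar X ≡ X
sub-id (tvar v) = refl
sub-id (A ⊗ B)  = cong₂ _⊗_ (sub-id A) (sub-id B)
sub-id (A ⇒ B)  = cong₂ _⇒_ (sub-id A) (sub-id B)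

occ-sub : ∀ {w} f X → Occ w (sub f X) → ∃[ u ] (Occ u X × Occ w (f u))
occ-sub f (tvar u) o = u , occ-var , o
occ-sub f (A ⊗ B) (occ-⊗ˡ o) with occ-sub f A o
... | u , oA , ow = u , occ-⊗ˡ oA , ow
occ-sub f (A ⊗ B) (occ-⊗ʳ o) with occ-sub f B o
... | u , oB , ow = u , occ-⊗ʳ oB , ow
occ-sub f (A ⇒ B) (occ-⇒ˡ o) with occ-sub f A o
... | u , oA , ow = u , occ-⇒ˡ oA , ow
occ-sub f (A ⇒ B) (occ-⇒ʳ o) with occ-sub f B o
... | u , oB , ow = u , occ-⇒ʳ oB , ow

-- The number of constructors of a type, the measure behind the occurs check.
size : Ty → ℕ
size (tvar _) = 1
size (A ⊗ B)  = suc (size A + size B)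
size (A ⇒ B)  = suc (size A + size B)

size-occ : ∀ θ {v} T → Occ v T → size (θ v) ≤ size (sub θ T)
size-occ θ (tvar v) occ-var    = ≤-refl
size-occ θ (A ⊗ B) (occ-⊗ˡ o) = ≤-trans (size-occ θ A o) (≤-trans (m≤m+n _ _) (n≤1+n _))
size-occ θ (A ⊗ B) (occ-⊗ʳ o) = ≤-trans (size-occ θ B o) (≤-trans (m≤n+m _ _) (n≤1+n _))
size-occ θ (A ⇒ B) (occ-⇒ˡ o) = ≤-trans (size-occ θ A o) (≤-trans (m≤m+n _ _) (n≤1+n _))
size-occ θ (A ⇒ B) (occ-⇒ʳ o) = ≤-trans (size-occ θ B o) (≤-trans (m≤n+m _ _) (n≤1+n _))

-- Occurs check: an equation v ≐ T with v in T is solvable only if T is v itself,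
-- because a proper subterm is strictly smaller.
occurs-check : ∀ θ {v} T → Occ v T → θ v ≡ sub θ T → T ≡ tvar v
occurs-check θ (tvar v) occ-var _ = refl
occurs-check θ (A ⊗ B) (occ-⊗ˡ o) e =
  ⊥-elim (<-irrefl (cong size e) (s≤s (≤-trans (size-occ θ A o) (m≤m+n _ _))))
occurs-check θ (A ⊗ B) (occ-⊗ʳ o) e =
  ⊥-elim (<-irrefl (cong size e) (s≤s (≤-trans (size-occ θ B o) (m≤n+m _ _))))
occurs-check θ (A ⇒ B) (occ-⇒ˡ o) e =
  ⊥-elim (<-irrefl (cong size e) (s≤s (≤-trans (size-occ θ A o) (m≤m+n _ _))))
occurs-check θ (A ⇒ B) (occ-⇒ʳ o) e =
  ⊥-elim (<-irrefl (cong size e) (s≤s (≤-trans (size-occ θ B o) (m≤n+m _ _))))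

fresh : Ty → ℕ
fresh (tvar v) = suc v
fresh (A ⊗ B)  = fresh A ⊔ fresh B
fresh (A ⇒ B)  = fresh A ⊔ fresh B

occ<fresh : ∀ {w} P → Occ w P → w < fresh P
occ<fresh (tvar v) occ-var    = ≤-refl
occ<fresh (A ⊗ B) (occ-⊗ˡ o) = ≤-trans (occ<fresh A o) (m≤m⊔n _ _)
occ<fresh (A ⊗ B) (occ-⊗ʳ o) = ≤-trans (occ<fresh B o) (m≤n⊔m _ _)
occ<fresh (A ⇒ B) (occ-⇒ˡ o) = ≤-trans (occ<fresh A o) (m≤m⊔n _ _)
occ<fresh (A ⇒ B) (occ-⇒ʳ o) = ≤-trans (occ<fresh B o) (m≤n⊔m _ _)

-- Renaming apart: shift m moves every variable above m, and glue m ρ τ acts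
-- as ρ below m and as τ on shifted variables.
shift : ℕ → TySubst
shift m v = tvar (m + v)

glue : ℕ → TySubst → TySubst → TySubst
glue m ρ τ v with v <? m
... | yes _ = ρ v
... | no _  = τ (v ∸ m)

glue-below : ∀ m ρ τ P → (∀ w → Occ w P → w < m) → sub (glue m ρ τ) P ≡ sub ρ P
glue-below m ρ τ P below = sub-cong P agree
  where
  agree : ∀ w → Occ w P → glue m ρ τ w ≡ ρ w
  agree w o with w <? m
  ... | yes _  = refl
  ... | no w≮m = ⊥-elim (w≮m (below w o))

glue-shift : ∀ m ρ τ P → sub (glue m ρ τ) (sub (shift m) P) ≡ sub τ P
glue-shift m ρ τ P = trans (sub-⊙ (glue m ρ τ) (shift m) P) (sub-cong P agree)
  where
  agree : ∀ w → Occ w P → glue m ρ τ (m + w) ≡ τ w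
  agree w _ with (m + w) <? m
  ... | yes m+w<m = ⊥-elim (<-irrefl refl (≤-trans m+w<m (m≤m+n m w)))
  ... | no _      = cong τ (m+n∸m≡n m w)

-- 2. Unification

Eqn : Set
Eqn = Ty × Ty

Unifies : TySubst → List Eqn → Set
Unifies θ = All (λ (S , T) → sub θ S ≡ sub θ T)

MGU : List Eqn → Set
MGU E = Σ TySubst λ σ → Unifies σ E × (∀ θ → Unifies θ E → ∀ w → sub θ (σ w) ≡ θ w)

-- Systems with the same unifiers have the same most general unifiers; this
-- justifies dropping trivial equations, orienting and decomposing.
mgu-transfer : ∀ {E E'} → (∀ θ → Unifies θ E → Unifies θ E') → (∀ θ → Unifies θ E' → Unifies θ E) →
               MGU E → MGU E'
mgu-transfer to from (σ , σ-unifies , σ-general) = σ , to σ σ-unifies , λ θ → σ-general θ ∘ from θ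

mgu-drop : ∀ {T E} → MGU E → MGU ((T , T) ∷ E)
mgu-drop = mgu-transfer (λ _ u → refl ∷ u) (λ { _ (_ ∷ u) → u })

mgu-flip : ∀ {S T E} → MGU ((T , S) ∷ E) → MGU ((S , T) ∷ E)
mgu-flip = mgu-transfer (λ { _ (q ∷ u) → sym q ∷ u }) (λ { _ (q ∷ u) → sym q ∷ u })

⊗-injective : ∀ {A B C D} → A ⊗ B ≡ C ⊗ D → A ≡ C × B ≡ D
⊗-injective refl = refl , refl

⇒-injective : ∀ {A B C D} → (A ⇒ B) ≡ (C ⇒ D) → A ≡ C × B ≡ D
⇒-injective refl = refl , refl

split-⊗ : ∀ θ {A B C D E} → Unifies θ ((A ⊗ B , C ⊗ D) ∷ E) → Unifies θ ((A , C) ∷ (B , D) ∷ E)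
split-⊗ θ (q ∷ u) = proj₁ (⊗-injective q) ∷ proj₂ (⊗-injective q) ∷ u

split-⇒ : ∀ θ {A B C D E} → Unifies θ ((A ⇒ B , C ⇒ D) ∷ E) → Unifies θ ((A , C) ∷ (B , D) ∷ E)
split-⇒ θ (q ∷ u) = proj₁ (⇒-injective q) ∷ proj₂ (⇒-injective q) ∷ u

mgu-⊗ : ∀ {A B C D E} → MGU ((A , C) ∷ (B , D) ∷ E) → MGU ((A ⊗ B , C ⊗ D) ∷ E)
mgu-⊗ = mgu-transfer (λ { _ (p ∷ q ∷ u) → cong₂ _⊗_ p q ∷ u }) (λ θ → split-⊗ θ)

mgu-⇒ : ∀ {A B C D E} → MGU ((A , C) ∷ (B , D) ∷ E) → MGU ((A ⇒ B , C ⇒ D) ∷ E)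
mgu-⇒ = mgu-transfer (λ { _ (p ∷ q ∷ u) → cong₂ _⇒_ p q ∷ u }) (λ θ → split-⇒ θ)

_↦_ : ℕ → Ty → TySubst
(v ↦ T) w with w ≟ v
... | yes _ = T
... | no _  = tvar w

↦-self : ∀ v T → (v ↦ T) v ≡ T
↦-self v T with v ≟ v
... | yes _  = refl
... | no v≢v = ⊥-elim (v≢v refl)

↦-absorbed : ∀ θ v T → θ v ≡ sub θ T → ∀ w → sub θ ((v ↦ T) w) ≡ θ w
↦-absorbed θ v T e w with w ≟ v
... | yes refl = sym e
... | no _     = refl

↦-fresh : ∀ v T X → ¬ Occ v X → sub (v ↦ T) X ≡ X
↦-fresh v T X v∉X = trans (sub-cong X unchanged) (sub-id X)
  where
  unchanged : ∀ w → Occ w X → (v ↦ T) w ≡ tvar w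
  unchanged w o with w ≟ v
  ... | yes refl = ⊥-elim (v∉X o)
  ... | no _     = refl

subE : TySubst → List Eqn → List Eqn
subE f = map (λ (S , T) → sub f S , sub f T)

unifies-⊙ : ∀ θ f E → Unifies θ (subE f E) → Unifies (θ ⊙ f) E
unifies-⊙ θ f []            []       = []
unifies-⊙ θ f ((S , T) ∷ E) (q ∷ u) = trans (sym (sub-⊙ θ f S)) (trans q (sub-⊙ θ f T)) ∷ unifies-⊙ θ f E u

unifies-↦ : ∀ θ v T → θ v ≡ sub θ T → ∀ E → Unifies θ E → Unifies θ (subE (v ↦ T) E)
unifies-↦ θ v T e []            []       = []
unifies-↦ θ v T e ((S , S') ∷ E) (q ∷ u) =
  trans (absorb S) (trans q (sym (absorb S'))) ∷ unifies-↦ θ v T e E u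
  where
  absorb : ∀ X → sub θ (sub (v ↦ T) X) ≡ sub θ X
  absorb X = trans (sub-⊙ θ (v ↦ T) X) (sub-cong X (λ w _ → ↦-absorbed θ v T e w))

mgu-eliminate : ∀ v T E → ¬ Occ v T → MGU (subE (v ↦ T) E) → MGU ((tvar v , T) ∷ E)
mgu-eliminate v T E v∉T (σ , σ-unifies , σ-general) =
  σ ⊙ (v ↦ T) , solves-v ∷ unifies-⊙ σ (v ↦ T) E σ-unifies , general
  where
  open ≡-Reasoning
  solves-v : sub σ ((v ↦ T) v) ≡ sub (σ ⊙ (v ↦ T)) T
  solves-v = begin
    sub σ ((v ↦ T) v)        ≡⟨ cong (sub σ) (↦-self v T) ⟩
    sub σ T                  ≡⟨ cong (sub σ) (↦-fresh v T T v∉T) ⟨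
    sub σ (sub (v ↦ T) T)    ≡⟨ sub-⊙ σ (v ↦ T) T ⟩
    sub (σ ⊙ (v ↦ T)) T      ∎
  general : ∀ θ → Unifies θ ((tvar v , T) ∷ E) → ∀ w → sub θ (sub σ ((v ↦ T) w)) ≡ θ w
  general θ (e ∷ u) w = begin
    sub θ (sub σ ((v ↦ T) w))  ≡⟨ sub-⊙ θ σ ((v ↦ T) w) ⟩
    sub (θ ⊙ σ) ((v ↦ T) w)    ≡⟨ sub-cong ((v ↦ T) w) (λ u' _ → σ-general θ (unifies-↦ θ v T e E u) u') ⟩
    sub θ ((v ↦ T) w)          ≡⟨ ↦-absorbed θ v T e w ⟩
    θ w                        ∎

OccE : ℕ → List Eqn → Set
OccE w []            = ⊥
OccE w ((S , T) ∷ E) = Occ w S ⊎ Occ w T ⊎ OccE w E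

sizeE : List Eqn → ℕ
sizeE []            = 0
sizeE ((S , T) ∷ E) = size S + size T + sizeE E

-- vs lists (at least) the variables of E; its length bounds the number of
-- eliminations still possible.
VarsIn : List ℕ → List Eqn → Set
VarsIn vs E = ∀ {w} → OccE w E → w ∈ vs

occE-sub : ∀ {w} f E → OccE w (subE f E) → ∃[ u ] (OccE u E × Occ w (f u))
occE-sub f ((S , T) ∷ E) (inj₁ o) with occ-sub f S o
... | u , oS , ow = u , inj₁ oS , ow
occE-sub f ((S , T) ∷ E) (inj₂ (inj₁ o)) with occ-sub f T o
... | u , oT , ow = u , inj₂ (inj₁ oT) , ow
occE-sub f ((S , T) ∷ E) (inj₂ (inj₂ o)) with occE-sub f E o
... | u , oE , ow = u , inj₂ (inj₂ oE) , ow

remove : ℕ → List ℕ → List ℕ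
remove v = filter (λ w → ¬? (w ≟ v))

remove-shorter : ∀ {v vs} → v ∈ vs → length (remove v vs) < length vs
remove-shorter {v} {vs} v∈vs =
  filter-notAll (λ w → ¬? (w ≟ v)) vs (Any.map (λ { refl w≢v → w≢v refl }) v∈vs)

vars-eliminate : ∀ {vs v T} E → ¬ Occ v T →
                 VarsIn vs ((tvar v , T) ∷ E) → VarsIn (remove v vs) (subE (v ↦ T) E)
vars-eliminate {vs} {v} {T} E v∉T V o with occE-sub (v ↦ T) E o
... | u , oE , ow with u ≟ v
...   | yes refl = ∈-filter⁺ _ (V (inj₂ (inj₁ ow))) λ { refl → v∉T ow }
...   | no u≢v with ow
...     | occ-var = ∈-filter⁺ _ (V (inj₂ (inj₂ oE))) u≢v

vars-flip : ∀ {vs S T E} → VarsIn vs ((S , T) ∷ E) → VarsIn vs ((T , S) ∷ E)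
vars-flip V (inj₁ o)        = V (inj₂ (inj₁ o))
vars-flip V (inj₂ (inj₁ o)) = V (inj₁ o)
vars-flip V (inj₂ (inj₂ o)) = V (inj₂ (inj₂ o))

vars-split : ∀ {vs A B C D S T E} →
             (∀ {w} → Occ w A ⊎ Occ w B → Occ w S) → (∀ {w} → Occ w C ⊎ Occ w D → Occ w T) →
             VarsIn vs ((S , T) ∷ E) → VarsIn vs ((A , C) ∷ (B , D) ∷ E)
vars-split inS inT V (inj₁ o)                      = V (inj₁ (inS (inj₁ o)))
vars-split inS inT V (inj₂ (inj₁ o))               = V (inj₂ (inj₁ (inT (inj₁ o))))
vars-split inS inT V (inj₂ (inj₂ (inj₁ o)))        = V (inj₁ (inS (inj₂ o)))
vars-split inS inT V (inj₂ (inj₂ (inj₂ (inj₁ o)))) = V (inj₂ (inj₁ (inT (inj₂ o))))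
vars-split inS inT V (inj₂ (inj₂ (inj₂ (inj₂ o)))) = V (inj₂ (inj₂ o))

occ-⊗ : ∀ {w A B} → Occ w A ⊎ Occ w B → Occ w (A ⊗ B)
occ-⊗ = [ occ-⊗ˡ , occ-⊗ʳ ]′

occ-⇒ : ∀ {w A B} → Occ w A ⊎ Occ w B → Occ w (A ⇒ B)
occ-⇒ = [ occ-⇒ˡ , occ-⇒ʳ ]′

-- Dropping or orienting an equation shrinks the system, since sizes are positive.
size-pos : ∀ T → 0 < size T
size-pos (tvar _) = s≤s z≤n
size-pos (_ ⊗ _)  = s≤s z≤n
size-pos (_ ⇒ _)  = s≤s z≤n

tail-smaller : ∀ S T E → sizeE E < sizeE ((S , T) ∷ E)
tail-smaller S T E = m<n+m (sizeE E) (≤-trans (size-pos S) (m≤m+n _ _))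

decompose-smaller : ∀ a b c d e → a + c + (b + d + e) < suc (a + b) + suc (c + d) + e
decompose-smaller a b c d e =
  subst (a + c + (b + d + e) <_) (sym (regroup a b c d e)) (s≤s (n≤1+n _))
  where
  regroup : ∀ a b c d e → suc (a + b) + suc (c + d) + e ≡ suc (suc (a + c + (b + d + e)))
  regroup = solve-∀

mutual
  -- Unification by the rules drop / orient / decompose / eliminate, by
  -- well-founded recursion on (number of variables, size of the system).
  -- The given unifier θ₀ excludes constructor clashes and failed occurs checks.
  unify : ∀ vs → Acc _<_ (length vs) → ∀ E → Acc _<_ (sizeE E) → VarsIn vs E →
          ∀ θ₀ → Unifies θ₀ E → MGU E
  unify vs n [] _ _ _ _ = tvar , [] , λ _ _ _ → refl
  unify vs n ((tvar v , T) ∷ E) (acc s) V θ₀ u =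
    solve-var vs n v T E (s (tail-smaller (tvar v) T E)) V θ₀ u
  unify vs n ((A ⊗ B , tvar v) ∷ E) (acc s) V θ₀ (q ∷ u) =
    mgu-flip (solve-var vs n v (A ⊗ B) E (s (tail-smaller (A ⊗ B) (tvar v) E)) (vars-flip V) θ₀ (sym q ∷ u))
  unify vs n ((A ⇒ B , tvar v) ∷ E) (acc s) V θ₀ (q ∷ u) =
    mgu-flip (solve-var vs n v (A ⇒ B) E (s (tail-smaller (A ⇒ B) (tvar v) E)) (vars-flip V) θ₀ (sym q ∷ u))
  unify vs n ((A ⊗ B , C ⊗ D) ∷ E) (acc s) V θ₀ u =
    mgu-⊗ (unify vs n ((A , C) ∷ (B , D) ∷ E) (s (decompose-smaller (size A) (size B) (size C) (size D) (sizeE E)))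
                 (vars-split occ-⊗ occ-⊗ V) θ₀ (split-⊗ θ₀ u))
  unify vs n ((A ⇒ B , C ⇒ D) ∷ E) (acc s) V θ₀ u =
    mgu-⇒ (unify vs n ((A , C) ∷ (B , D) ∷ E) (s (decompose-smaller (size A) (size B) (size C) (size D) (sizeE E)))
                 (vars-split occ-⇒ occ-⇒ V) θ₀ (split-⇒ θ₀ u))
  unify vs n ((A ⊗ B , C ⇒ D) ∷ E) _ _ θ₀ (() ∷ _)
  unify vs n ((A ⇒ B , C ⊗ D) ∷ E) _ _ θ₀ (() ∷ _)

  -- An equation v ≐ T: trivial if T is v, otherwise eliminate v (the occurs
  -- check cannot fail, θ₀ being a solution).
  solve-var : ∀ vs → Acc _<_ (length vs) → ∀ v T E → Acc _<_ (sizeE E) →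
              VarsIn vs ((tvar v , T) ∷ E) → ∀ θ₀ → Unifies θ₀ ((tvar v , T) ∷ E) →
              MGU ((tvar v , T) ∷ E)
  solve-var vs a v T E s V θ₀ (q ∷ u) with occ? v T
  ... | yes v∈T with refl ← occurs-check θ₀ T v∈T q =
    mgu-drop (unify vs a E s (V ∘ inj₂ ∘ inj₂) θ₀ u)
  solve-var vs (acc n) v T E s V θ₀ (q ∷ u) | no v∉T =
    mgu-eliminate v T E v∉T
      (unify (remove v vs) (n (remove-shorter (V (inj₁ occ-var)))) (subE (v ↦ T) E) (<-wellFounded _)
             (vars-eliminate E v∉T V) θ₀ (unifies-↦ θ₀ v T q E u))

varsT : Ty → List ℕ
varsT (tvar v) = v ∷ []
varsT (A ⊗ B)  = varsT A ++ varsT B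
varsT (A ⇒ B)  = varsT A ++ varsT B

occ∈varsT : ∀ {w} T → Occ w T → w ∈ varsT T
occ∈varsT (tvar v) occ-var    = here refl
occ∈varsT (A ⊗ B) (occ-⊗ˡ o) = ∈-++⁺ˡ (occ∈varsT A o)
occ∈varsT (A ⊗ B) (occ-⊗ʳ o) = ∈-++⁺ʳ (varsT A) (occ∈varsT B o)
occ∈varsT (A ⇒ B) (occ-⇒ˡ o) = ∈-++⁺ˡ (occ∈varsT A o)
occ∈varsT (A ⇒ B) (occ-⇒ʳ o) = ∈-++⁺ʳ (varsT A) (occ∈varsT B o)

varsE : List Eqn → List ℕ
varsE []            = []
varsE ((S , T) ∷ E) = varsT S ++ varsT T ++ varsE E

varsE-complete : ∀ E → VarsIn (varsE E) E
varsE-complete ((S , T) ∷ E) (inj₁ o)        = ∈-++⁺ˡ (occ∈varsT S o)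
varsE-complete ((S , T) ∷ E) (inj₂ (inj₁ o)) = ∈-++⁺ʳ (varsT S) (∈-++⁺ˡ (occ∈varsT T o))
varsE-complete ((S , T) ∷ E) (inj₂ (inj₂ o)) = ∈-++⁺ʳ (varsT S) (∈-++⁺ʳ (varsT T) (varsE-complete E o))

mgu : ∀ E θ₀ → Unifies θ₀ E → MGU E
mgu E = unify (varsE E) (<-wellFounded _) E (<-wellFounded _) (varsE-complete E)

-- 3. Linear typing

unique-↭ : ∀ {xs ys : List ℕ} → xs ↭ ys → Unique xs → Unique ys
unique-↭ p = Unique-resp-↭ (setoid ℕ) (↭⇒↭ₛ p)

ctx-unique : ∀ {Γ t A} → Γ ⊢ t ∶ A → Unique (dom Γ)
ctx-unique ax          = [] ∷ []
ctx-unique (exch p d)  = unique-↭ (map⁺ proj₁ p) (ctx-unique d)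
ctx-unique (⇒I d) with ctx-unique d
... | _ ∷ u = u
ctx-unique (⇒E u _ _) = u
ctx-unique (⊗I u _ _) = u
ctx-unique (⊗E u _ _) = u

data Free (y : ℕ) : Tm → Set where
  free-var   : Free y (var y)
  free-appˡ  : ∀ {t s} → Free y t → Free y (app t s)
  free-appʳ  : ∀ {t s} → Free y s → Free y (app t s)
  free-lam   : ∀ {x t} → y ≢ x → Free y t → Free y (lam x t)
  free-pairˡ : ∀ {s t} → Free y s → Free y (pair s t)
  free-pairʳ : ∀ {s t} → Free y t → Free y (pair s t)
  free-letˡ  : ∀ {x z s t} → Free y s → Free y (letp x z s t)
  free-letʳ  : ∀ {x z s t} → y ≢ x → y ≢ z → Free y t → Free y (letp x z s t)

∈-dom-++⁻ : ∀ {y} Γ Δ → y ∈ dom (Γ ++ Δ) → y ∈ dom Γ ⊎ y ∈ dom Δ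
∈-dom-++⁻ Γ Δ m = ∈-++⁻ (dom Γ) (subst (_ ∈_) (map-++ proj₁ Γ Δ) m)

∈-dom-++ˡ : ∀ {y} Γ Δ → y ∈ dom Γ → y ∈ dom (Γ ++ Δ)
∈-dom-++ˡ Γ Δ m = subst (_ ∈_) (sym (map-++ proj₁ Γ Δ)) (∈-++⁺ˡ m)

∈-dom-++ʳ : ∀ {y} Γ Δ → y ∈ dom Δ → y ∈ dom (Γ ++ Δ)
∈-dom-++ʳ Γ Δ m = subst (_ ∈_) (sym (map-++ proj₁ Γ Δ)) (∈-++⁺ʳ (dom Γ) m)

free⇒dom : ∀ {Γ t A y} → Γ ⊢ t ∶ A → Free y t → y ∈ dom Γ
free⇒dom ax free-var = here refl
free⇒dom (exch p d) f = ∈-resp-↭ (map⁺ proj₁ p) (free⇒dom d f)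
free⇒dom (⇒I d) (free-lam y≢x f) with free⇒dom d f
... | here y≡x = ⊥-elim (y≢x y≡x)
... | there m  = m
free⇒dom (⇒E {Γ} {Δ} _ d e) (free-appˡ f)  = ∈-dom-++ˡ Γ Δ (free⇒dom d f)
free⇒dom (⇒E {Γ} {Δ} _ d e) (free-appʳ f)  = ∈-dom-++ʳ Γ Δ (free⇒dom e f)
free⇒dom (⊗I {Γ} {Δ} _ d e) (free-pairˡ f) = ∈-dom-++ˡ Γ Δ (free⇒dom d f)
free⇒dom (⊗I {Γ} {Δ} _ d e) (free-pairʳ f) = ∈-dom-++ʳ Γ Δ (free⇒dom e f)
free⇒dom (⊗E {Γ} {Δ} _ d e) (free-letˡ f)  = ∈-dom-++ˡ Γ Δ (free⇒dom d f)
free⇒dom (⊗E {Γ} {Δ} _ d e) (free-letʳ y≢x y≢z f) with free⇒dom e f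
... | here y≡x         = ⊥-elim (y≢x y≡x)
... | there (here y≡z) = ⊥-elim (y≢z y≡z)
... | there (there m)  = ∈-dom-++ʳ Γ Δ m

dom⇒free : ∀ {Γ t A y} → Γ ⊢ t ∶ A → y ∈ dom Γ → Free y t
dom⇒free ax (here refl) = free-var
dom⇒free (exch p d) m = dom⇒free d (∈-resp-↭ (↭-sym (map⁺ proj₁ p)) m)
dom⇒free (⇒I d) m with ctx-unique d
... | x∉Γ ∷ _ = free-lam (≢-sym (All-lookup x∉Γ m)) (dom⇒free d (there m))
dom⇒free (⇒E {Γ} {Δ} _ d e) m with ∈-dom-++⁻ Γ Δ m
... | inj₁ m = free-appˡ (dom⇒free d m)
... | inj₂ m = free-appʳ (dom⇒free e m)
dom⇒free (⊗I {Γ} {Δ} _ d e) m with ∈-dom-++⁻ Γ Δ m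
... | inj₁ m = free-pairˡ (dom⇒free d m)
... | inj₂ m = free-pairʳ (dom⇒free e m)
dom⇒free (⊗E {Γ} {Δ} _ d e) m with ∈-dom-++⁻ Γ Δ m
... | inj₁ m = free-letˡ (dom⇒free d m)
... | inj₂ m with ctx-unique e
...   | (_ ∷ x∉Δ) ∷ (z∉Δ ∷ _) =
  free-letʳ (≢-sym (All-lookup x∉Δ m)) (≢-sym (All-lookup z∉Δ m)) (dom⇒free e (there (there m)))

-- A closed term has no free variables, so it is typable only in the empty context.
closed-context : ∀ {t A Γ B} → Closed t A → Γ ⊢ t ∶ B → Γ ≡ []
closed-context {Γ = []} _ _ = refl
closed-context {Γ = (y , _) ∷ Γ} c d with free⇒dom c (dom⇒free d (here refl))
... | ()

as-closed : ∀ {t A Γ B} → Closed t A → Γ ⊢ t ∶ B → Closed t B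
as-closed c d with refl ← closed-context c d = d

subC : TySubst → Ctx → Ctx
subC θ = map (map₂ (sub θ))

dom-subC : ∀ θ Γ → dom (subC θ Γ) ≡ dom Γ
dom-subC θ Γ = sym (map-∘ Γ)

-- The side conditions of the binary rules only concern the domain,
-- which a type substitution leaves unchanged.
sub-binary : ∀ θ Γ Δ {t A} → (Unique (dom (subC θ Γ ++ subC θ Δ)) → (subC θ Γ ++ subC θ Δ) ⊢ t ∶ A) →
             Unique (dom (Γ ++ Δ)) → subC θ (Γ ++ Δ) ⊢ t ∶ A
sub-binary θ Γ Δ {t} {A} rule u =
  subst (λ G → G ⊢ t ∶ A) (sym split)
        (rule (subst Unique (sym (trans (cong dom (sym split)) (dom-subC θ (Γ ++ Δ)))) u))
  where
  split : subC θ (Γ ++ Δ) ≡ subC θ Γ ++ subC θ Δ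
  split = map-++ (map₂ (sub θ)) Γ Δ

sub-typing : ∀ θ {Γ t A} → Γ ⊢ t ∶ A → subC θ Γ ⊢ t ∶ sub θ A
sub-typing θ ax         = ax
sub-typing θ (exch p d) = exch (map⁺ (map₂ (sub θ)) p) (sub-typing θ d)
sub-typing θ (⇒I d)     = ⇒I (sub-typing θ d)
sub-typing θ (⇒E {Γ} {Δ} u d e) = sub-binary θ Γ Δ (λ u' → ⇒E u' (sub-typing θ d) (sub-typing θ e)) u
sub-typing θ (⊗I {Γ} {Δ} u d e) = sub-binary θ Γ Δ (λ u' → ⊗I u' (sub-typing θ d) (sub-typing θ e)) u
sub-typing θ (⊗E {Γ} {Δ} u d e) = sub-binary θ Γ Δ (λ u' → ⊗E u' (sub-typing θ d) (sub-typing θ e)) u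

instantiate : ∀ θ {Γ t P A} → Γ ⊢ t ∶ P → sub θ P ≡ A → subC θ Γ ⊢ t ∶ A
instantiate θ d refl = sub-typing θ d

inv-var : ∀ {Γ x A} → Γ ⊢ var x ∶ A → Γ ↭ (x , A) ∷ []
inv-var ax         = _↭_.refl
inv-var (exch p d) = ↭-trans (↭-sym p) (inv-var d)

inv-app : ∀ {Γ t s B} → Γ ⊢ app t s ∶ B →
          ∃[ Γ₁ ] ∃[ Γ₂ ] ∃[ A ] (Γ ↭ Γ₁ ++ Γ₂ × Γ₁ ⊢ t ∶ A ⇒ B × Γ₂ ⊢ s ∶ A)
inv-app (exch p d) with inv-app d
... | Γ₁ , Γ₂ , A , p' , dt , ds = Γ₁ , Γ₂ , A , ↭-trans (↭-sym p) p' , dt , ds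
inv-app (⇒E {Γ} {Δ} {A = A} _ dt ds) = Γ , Δ , A , _↭_.refl , dt , ds

inv-lam : ∀ {Γ x t T} → Γ ⊢ lam x t ∶ T →
          ∃[ A ] ∃[ B ] ∃[ Γ' ] (T ≡ A ⇒ B × Γ ↭ Γ' × (x , A) ∷ Γ' ⊢ t ∶ B)
inv-lam (exch p d) with inv-lam d
... | A , B , Γ' , e , p' , d' = A , B , Γ' , e , ↭-trans (↭-sym p) p' , d'
inv-lam (⇒I {A = A} {Γ} {B = B} d) = A , B , Γ , refl , _↭_.refl , d

-- 4. The composite fn x => t' (t x) and its principal type

compose : ℕ → Tm → Tm → Tm
compose x t t' = lam x (app t' (app t (var x)))

compose-typing : ∀ x {t t' X Y Z} → Closed t (X ⇒ Y) → Closed t' (Y ⇒ Z) → Closed (compose x t t') (X ⇒ Z)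
compose-typing x dt dt' = ⇒I (⇒E ([] ∷ []) dt' (⇒E ([] ∷ []) dt ax))

compose-inversion : ∀ x {t t' P P' Γ T} → Closed t P → Closed t' P' → Γ ⊢ compose x t t' ∶ T →
                    ∃[ X ] ∃[ Y ] ∃[ Z ] (T ≡ X ⇒ Z × Closed t (X ⇒ Y) × Closed t' (Y ⇒ Z))
compose-inversion x ct ct' d with inv-lam d
... | X , Z , Γ , refl , _ , d-body with inv-app d-body
... | Γ₁ , Γ₂ , Y , p₁ , dt' , d-arg with inv-app d-arg
... | Γ₃ , Γ₄ , X' , p₂ , dt , dx with closed-context ct' dt' | closed-context ct dt
... | refl | refl = X , Y , Z , refl , subst (λ W → Closed _ (W ⇒ Y)) (sym X≡X') dt , dt'
  where
  -- the context (x , X) ∷ Γ is a permutation of the context [(x , X')] of var x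
  X≡X' : X ≡ X'
  X≡X' with ∈-resp-↭ (↭-trans p₁ (↭-trans p₂ (inv-var dx))) (here refl)
  ... | here refl = refl

pt-closed : ∀ {t A P} → Closed t A → IsPT t P → Closed t P
pt-closed c ((_ , d) , _) = as-closed c d

-- Values for three fresh variables α = 0, β = 1, γ = 2.
slots : Ty → Ty → Ty → TySubst
slots X Y Z 0 = X
slots X Y Z 1 = Y
slots X Y Z 2 = Z
slots X Y Z (suc (suc (suc n))) = tvar n

-- PT(t) ≐ α ⇒ β  and  PT(t') ≐ β ⇒ γ,  with PT(t) and PT(t') renamed apart
-- from each other and from α, β, γ.
composition-equations : Ty → Ty → List Eqn
composition-equations Pt Pt' =
  (sub (shift 3) Pt , tvar 0 ⇒ tvar 1) ∷ (sub (shift 3) (sub (shift (fresh Pt)) Pt') , tvar 1 ⇒ tvar 2) ∷ []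

composition-unifier : ∀ Pt Pt' {θ θ' X Y Z} → sub θ Pt ≡ X ⇒ Y → sub θ' Pt' ≡ Y ⇒ Z →
                      Unifies (glue 3 (slots X Y Z) (glue (fresh Pt) θ θ')) (composition-equations Pt Pt')
composition-unifier Pt Pt' {θ} {θ'} {X} {Y} {Z} e e' =
  trans (glue-shift 3 (slots X Y Z) τ Pt) (trans (glue-below (fresh Pt) θ θ' Pt (λ _ → occ<fresh Pt)) e) ∷
  trans (glue-shift 3 (slots X Y Z) τ (sub (shift (fresh Pt)) Pt')) (trans (glue-shift (fresh Pt) θ θ' Pt') e') ∷
  []
  where
  τ : TySubst
  τ = glue (fresh Pt) θ θ'

compose-principal : ∀ x {t t' Pt Pt' X Y Z} → IsPT t Pt → IsPT t' Pt' →
                    Closed t (X ⇒ Y) → Closed t' (Y ⇒ Z) → ∃[ P ] IsPT (compose x t t') P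
compose-principal x {t} {t'} {Pt} {Pt'} ptT ptT' dt dt'
  with proj₂ ptT [] _ dt | proj₂ ptT' [] _ dt'
... | _ , e | _ , e' with mgu (composition-equations Pt Pt') _ (composition-unifier Pt Pt' e e')
... | σ , q ∷ q' ∷ [] , σ-general = σ 0 ⇒ σ 2 , ([] , compose-typing x d d') , principal
  where
  d : Closed t (σ 0 ⇒ σ 1)
  d = instantiate σ (sub-typing (shift 3) (pt-closed dt ptT)) q
  d' : Closed t' (σ 1 ⇒ σ 2)
  d' = instantiate σ (sub-typing (shift 3) (sub-typing (shift (fresh Pt)) (pt-closed dt' ptT'))) q'
  principal : ∀ Γ A → Γ ⊢ compose x t t' ∶ A → ∃[ θ ] (sub θ (σ 0 ⇒ σ 2) ≡ A)
  principal Γ A d-A with compose-inversion x dt dt' d-A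
  ... | X , Y , Z , refl , dt₁ , dt₁' with proj₂ ptT [] _ dt₁ | proj₂ ptT' [] _ dt₁'
  ... | θ₁ , e₁ | θ₁' , e₁' =
    Θ , cong₂ _⇒_ (σ-general Θ Θ-unifies 0) (σ-general Θ Θ-unifies 2)
    where
    Θ : TySubst
    Θ = glue 3 (slots X Y Z) (glue (fresh Pt) θ₁ θ₁')
    Θ-unifies : Unifies Θ (composition-equations Pt Pt')
    Θ-unifies = composition-unifier Pt Pt' e₁ e₁'

IsPT-shift : ∀ m {t P} → IsPT t P → IsPT t (sub (shift m) P)
IsPT-shift m {t} {P} ((Γ , d) , principal) = (subC (shift m) Γ , sub-typing (shift m) d) , shifted
  where
  shifted : ∀ Γ' A → Γ' ⊢ t ∶ A → ∃[ θ ] (sub θ (sub (shift m) P) ≡ A)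
  shifted Γ' A d' with principal Γ' A d'
  ... | θ , e = glue m tvar θ , trans (glue-shift m tvar θ P) e

rename-apart : ∀ {s u Ps Pu Γ Γ' A B} → IsPT s Ps → IsPT u Pu → Γ ⊢ s ∶ A → Γ' ⊢ u ∶ B →
               ∃[ Pu' ] (IsPT u Pu' × ∃[ θ ] (sub θ Pu' ≡ B × sub θ Ps ≡ A))
rename-apart {Ps = Ps} {Pu} (_ , s-principal) ptU ds du
  with s-principal _ _ ds | proj₂ ptU _ _ du
... | ρ , e | τ , e' =
  sub (shift (fresh Ps)) Pu , IsPT-shift (fresh Ps) ptU , glue (fresh Ps) ρ τ ,
  trans (glue-shift (fresh Ps) ρ τ Pu) e' ,
  trans (glue-below (fresh Ps) ρ τ Ps (λ _ → occ<fresh Ps)) e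

compose-polytypable-at : ∀ x {s t t' Pt Pt' Ps Γ A X Y C} →
                         IsPT t Pt → IsPT t' Pt' → IsPT s Ps → Closed s A →
                         Closed t (X ⇒ Y) → Closed t' (Y ⇒ C) → Γ ⊢ s ∶ X →
                         PolyTypable (compose x t t') A C s
compose-polytypable-at x {Ps = Ps} {X = X} {C = C} ptT ptT' ptS cs dt dt' ds
  with compose-principal x ptT ptT' dt dt'
... | _ , ptU with rename-apart ptS ptU ds (compose-typing x dt dt')
... | Pu , ptU' , θ , eU , eS =
  (X , C , compose-typing x dt dt') , cs , Pu , Ps , ptU' , ptS , θ , X , eU , eS

-- One half of Proposition 5: the hypothesis on t' yields a typing of t s at
-- the argument type A₀ of t', hence t : X ⇒ A₀ and s : X for some X.
compose-polytypable : ∀ x {s t t' A B C} → PolyTypable t A B s → PolyTypable t' B C (app t s) →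
                      PolyTypable (compose x t t') A C s
compose-polytypable x ((_ , _ , ct) , cs , _ , _ , ptT , ptS , _)
                      ((_ , _ , ct') , cts , _ , _ , ptT' , ptTS , θ , _ , e' , eTS)
  with inv-app (instantiate θ (pt-closed cts ptTS) eTS)
... | _ , _ , _ , _ , dt , ds =
  compose-polytypable-at x ptT ptT' ptS cs (as-closed ct dt) (instantiate θ (pt-closed ct' ptT') e') ds

proposition5 : (s s' t t' : Tm) (A B C : Ty) (x : ℕ) →
    Closed s A → Closed s' A →
    PolyTypable t A B s → PolyTypable t A B s' →
    PolyTypable t' B C (app t s) → PolyTypable t' B C (app t s') →
    PolyTypable (lam x (app t' (app t (var x)))) A C s ×
    PolyTypable (lam x (app t' (app t (var x)))) A C s'
proposition5 s s' t t' A B C x _ _ t-s t-s' t'-ts t'-ts' =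
  compose-polytypable x t-s t'-ts , compose-polytypable x t-s' t'-ts'
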